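{- For all integers $n\ge 1$ and $k\ge 1$, $\chi_{la}\big((2k+1)P_2 \vee O_{2n}\big) = 3$.
   Context: For a graph $G$ with $q$ edges, a bijection $f:E(G)\to\{1,2,\dots,q\}$ is a local antimagic labeling if $f^+(u)\neq f^+(v)$ for every edge $uv$, where $f^+(u)$ is the sum of $f(e)$ over all edges $e$ incident to $u$. The local antimagic chromatic number $\chi_{la}(G)$ is the minimum, over all local antimagic labelings $f$ of $G$, of the number of distinct values of $f^+$. $O_m$ denotes the null graph (no edges) on $m$ vertices, $aP_2$ denotes the disjoint union of $a$ copies of the path $P_2$ (a single edge), and $G\vee H$ denotes the join of $G$ and $H$ (disjoint union plus all edges between $V(G)$ and $V(H)$). -}

module Defs where

open import Data.Nat using (ℕ; zero; suc; _+_; _*_; _≤_; _≟_)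
open import Data.Fin using (Fin; toℕ) renaming (zero to fzero; suc to fsuc)
open import Data.Fin.Permutation using (Permutation′; _⟨$⟩ʳ_)
open import Data.List using (List; []; _∷_; map; upTo; length; lookup; concatMap; deduplicate; _++_)
open import Data.Product using (_×_; _,_; proj₁; proj₂; Σ; ∃)
open import Data.Bool using (Bool; if_then_else_; _∨_)
open import Relation.Nullary using (¬_)
open import Relation.Nullary.Decidable using (⌊_⌋)
open import Relation.Binary.PropositionalEquality using (_≡_)

-- A finite simple graph: vertices are 0 , 1 , … , V-1 ; edges are a list of
-- (unordered) pairs of distinct vertices, each edge listed exactly once.
record Graph : Set where
  constructor mkGraph
  field
    V : ℕ
    E : List (ℕ × ℕ)
open Graph public

q : Graph → ℕ
q G = length (E G)

edge : (G : Graph) → Fin (q G) → ℕ × ℕ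
edge G i = lookup (E G) i

ΣFin : (n : ℕ) → (Fin n → ℕ) → ℕ
ΣFin zero    f = 0
ΣFin (suc n) f = f fzero + ΣFin n (λ i → f (fsuc i))

-- A labeling is a bijection f : E(G) → {1,…,q}; we represent it by a
-- permutation σ of Fin q, with f(e) = toℕ (σ e) + 1.
Labeling : Graph → Set
Labeling G = Permutation′ (q G)

label : (G : Graph) → Labeling G → Fin (q G) → ℕ
label G σ e = suc (toℕ (σ ⟨$⟩ʳ e))

incident : ℕ → ℕ × ℕ → Bool
incident u (a , b) = ⌊ u ≟ a ⌋ ∨ ⌊ u ≟ b ⌋

vsum : (G : Graph) → Labeling G → ℕ → ℕ
vsum G σ u = ΣFin (q G) (λ e → if incident u (edge G e) then label G σ e else 0)

IsLocalAntimagic : (G : Graph) → Labeling G → Set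
IsLocalAntimagic G σ =
  (e : Fin (q G)) → ¬ (vsum G σ (proj₁ (edge G e)) ≡ vsum G σ (proj₂ (edge G e)))

numColors : (G : Graph) → Labeling G → ℕ
numColors G σ = length (deduplicate _≟_ (map (vsum G σ) (upTo (V G))))

IsLocalAntimagicChromaticNumber : Graph → ℕ → Set
IsLocalAntimagicChromaticNumber G c =
  (Σ (Labeling G) λ σ → IsLocalAntimagic G σ × numColors G σ ≡ c)
  × ((σ : Labeling G) → IsLocalAntimagic G σ → c ≤ numColors G σ)

-- a P₂ ∨ O_m : vertices 0 … 2a-1 form the a copies of P₂ (edges {2i, 2i+1}),
-- vertices 2a … 2a+m-1 form O_m; every vertex of aP₂ is joined to every vertex of O_m.
matchingJoinNull : ℕ → ℕ → Graph
matchingJoinNull a m =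
  mkGraph (2 * a + m)
    ( map (λ i → (2 * i , suc (2 * i))) (upTo a)
   ++ concatMap (λ x → map (λ y → (x , 2 * a + y)) (upTo m)) (upTo (2 * a)))

-- Let a = 2k + 1 and m = 2n, let u_i v_i (i < a) be the matching edges and w_y (y < m) the
-- vertices of O_m. Label u_i v_i with i + 1, and u_i w_y (resp. v_i w_y) with L a + o + 1, where the
-- level L is 1 + y (resp. 2m - y) and the offset o < a runs through a permutation of 0 … a - 1 on
-- each level; this uses each of the labels 1 … (2m + 1) a once. All u_i then get the same vertex
-- sum, and so do all v_i, if the offsets at u_i summed over the levels, plus i, do not depend on i
-- (likewise for v_i); all w_y get the same sum if the offsets of u_i w_y and v_i w_y summed over i
-- do not depend on y. Both hold when the first two levels are filled from a 3 × (2k + 1) magic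
-- rectangle on 0 … 2k and the remaining 2n - 2 levels alternate between i and 2k - i. The three
-- sums are distinct, and u_0, v_0, w_0 form a triangle, so no local antimagic labeling uses fewer.
{-# OPTIONS --safe #-}
module Submission where

open import Defs
open import Data.Bool using (true; false; if_then_else_; _∨_)
open import Data.Bool.Properties using (∨-zeroʳ)
open import Data.Fin using (Fin; toℕ; fromℕ<; punchOut) renaming (zero to fzero; suc to fsuc)
open import Data.Fin.Permutation using (_⟨$⟩ʳ_; permutation)
open import Data.Fin.Properties using (any?; punchOut-injective; injective⇒≤; toℕ-fromℕ<; toℕ-injective; toℕ<n)
  renaming (_≟_ to _≟ᶠ_)
open import Data.List using (List; []; _∷_; _++_; map; upTo; applyUpTo; length; lookup; concatMap)
open import Data.List.Membership.Propositional using (_∈_)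
open import Data.List.Membership.Propositional.Properties
  using (∈-∃++; ∈-++⁻; ∈-++⁺ˡ; ∈-++⁺ʳ; ∈-map⁺; ∈-map⁻; ∈-upTo⁺; ∈-upTo⁻; ∈-deduplicate⁺; ∈-deduplicate⁻)
open import Data.List.Properties using (length-++; length-++-sucʳ; length-map; length-upTo; map-applyUpTo)
open import Data.List.Relation.Binary.Subset.Propositional using (_⊆_)
open import Data.List.Relation.Unary.All as All using ([]; _∷_)
open import Data.List.Relation.Unary.Any using (here; there)
open import Data.List.Relation.Unary.Unique.Propositional using (Unique; []; _∷_)
open import Data.Nat using (ℕ; zero; suc; _+_; _*_; _∸_; _<_; _≤_; s≤s; z≤n)
open import Data.Nat.Divisibility using (_∣_; ∣m+n∣m⇒∣n; ∣1⇒≡1; ∣⇒≤; n∣m*n; m∣m*n)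
open import Data.Nat.DivMod using (_/_; _%_; m≡m%n+[m/n]*n; m%n<n; m<n*o⇒m/o<n; [m+kn]%n≡m%n; m<n⇒m%n≡m)
open import Data.Nat.Properties
open import Data.Nat.Tactic.RingSolver using (solve-∀)
open import Data.Product using (∃; ∃₂; _×_; _,_; proj₁; proj₂)
open import Data.Sum using (_⊎_; inj₁; inj₂)
open import Function using (_∘_)
open import Relation.Nullary using (yes; no; contradiction)
open import Relation.Nullary.Decidable using (⌊_⌋; isYes≗does; dec-true; dec-false)
open import Relation.Binary.PropositionalEquality
open import Algebra.Properties.CommutativeSemigroup +-commutativeSemigroup using (interchange)
open import Data.List.Relation.Unary.Unique.DecPropositional.Properties _≟_ using (deduplicate-!)

-- Sums over initial segments of ℕ

∑< : ℕ → (ℕ → ℕ) → ℕ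
∑< zero    f = 0
∑< (suc N) f = f 0 + ∑< N (λ t → f (suc t))

syntax ∑< N (λ t → e) = ∑[ t < N ] e

ΣFin≡∑ : ∀ N {f : Fin N → ℕ} {g : ℕ → ℕ} → (∀ e → f e ≡ g (toℕ e)) → ΣFin N f ≡ ∑[ t < N ] g t
ΣFin≡∑ zero    f≗g = refl
ΣFin≡∑ (suc N) f≗g = cong₂ _+_ (f≗g fzero) (ΣFin≡∑ N (λ e → f≗g (fsuc e)))

∑-cong : ∀ N {f g : ℕ → ℕ} → (∀ {t} → t < N → f t ≡ g t) → ∑[ t < N ] f t ≡ ∑[ t < N ] g t
∑-cong zero    f≗g = refl
∑-cong (suc N) f≗g = cong₂ _+_ (f≗g (s≤s z≤n)) (∑-cong N (λ t<N → f≗g (s≤s t<N)))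

∑-distrib-+ : ∀ N (f g : ℕ → ℕ) → ∑[ t < N ] (f t + g t) ≡ ∑[ t < N ] f t + ∑[ t < N ] g t
∑-distrib-+ zero    f g = refl
∑-distrib-+ (suc N) f g =
  trans (cong (f 0 + g 0 +_) (∑-distrib-+ N (λ t → f (suc t)) (λ t → g (suc t)))) (interchange (f 0) (g 0) _ _)

∑-distribʳ-* : ∀ N (f : ℕ → ℕ) c → ∑[ t < N ] (f t * c) ≡ (∑[ t < N ] f t) * c
∑-distribʳ-* zero    f c = refl
∑-distribʳ-* (suc N) f c = trans (cong (f 0 * c +_) (∑-distribʳ-* N _ c)) (sym (*-distribʳ-+ c (f 0) _))

∑-const : ∀ N c → ∑[ t < N ] c ≡ N * c
∑-const zero    c = refl
∑-const (suc N) c = cong (c +_) (∑-const N c)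

∑-suc : ∀ N (f : ℕ → ℕ) → ∑[ t < N ] suc (f t) ≡ N + ∑[ t < N ] f t
∑-suc N f = trans (∑-distrib-+ N (λ _ → 1) f) (cong (_+ ∑[ t < N ] f t) (trans (∑-const N 1) (*-identityʳ N)))

∑-zero : ∀ N (f : ℕ → ℕ) → (∀ {t} → t < N → f t ≡ 0) → ∑[ t < N ] f t ≡ 0
∑-zero N f f≗0 = trans (∑-cong N f≗0) (trans (∑-const N 0) (*-zeroʳ N))

∑-single : ∀ N (f : ℕ → ℕ) {i} → i < N → (∀ {t} → t < N → t ≢ i → f t ≡ 0) → ∑[ t < N ] f t ≡ f i
∑-single (suc N) f {zero} _ f≗0 =
  trans (cong (f 0 +_) (∑-zero N (λ t → f (suc t)) (λ t<N → f≗0 (s≤s t<N) λ ()))) (+-identityʳ _)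
∑-single (suc N) f {suc i} (s≤s i<N) f≗0 =
  trans (cong (_+ ∑[ t < N ] f (suc t)) (f≗0 (s≤s z≤n) λ ()))
        (∑-single N (λ t → f (suc t)) i<N (λ t<N t≢i → f≗0 (s≤s t<N) (t≢i ∘ suc-injective)))

∑-+ : ∀ A B (f : ℕ → ℕ) → ∑[ t < A + B ] f t ≡ ∑[ t < A ] f t + ∑[ t < B ] f (A + t)
∑-+ zero    B f = refl
∑-+ (suc A) B f = trans (cong (f 0 +_) (∑-+ A B _)) (sym (+-assoc (f 0) _ _))

∑-* : ∀ X M (f : ℕ → ℕ) → ∑[ t < X * M ] f t ≡ ∑[ x < X ] ∑[ y < M ] f (x * M + y)
∑-* zero    M f = refl
∑-* (suc X) M f = begin
  ∑[ t < M + X * M ] f t                                     ≡⟨ ∑-+ M (X * M) f ⟩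
  ∑[ y < M ] f y + ∑[ t < X * M ] f (M + t)                  ≡⟨ cong (_ +_) (∑-* X M _) ⟩
  ∑[ y < M ] f y + ∑[ x < X ] ∑[ y < M ] f (M + (x * M + y))
    ≡⟨ cong (_ +_) (∑-cong X λ _ → ∑-cong M λ _ → cong f (sym (+-assoc M _ _))) ⟩
  ∑[ y < M ] f y + ∑[ x < X ] ∑[ y < M ] f (suc x * M + y)   ∎
  where open ≡-Reasoning

∑-snoc : ∀ N (f : ℕ → ℕ) → ∑[ t < suc N ] f t ≡ ∑[ t < N ] f t + f N
∑-snoc zero    f = +-identityʳ (f 0)
∑-snoc (suc N) f = trans (cong (f 0 +_) (∑-snoc N _)) (sym (+-assoc (f 0) _ _))

∑-reverse : ∀ N (f : ℕ → ℕ) → ∑[ t < N ] f (N ∸ suc t) ≡ ∑[ t < N ] f t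
∑-reverse zero    f = refl
∑-reverse (suc N) f = begin
  f N + ∑[ t < N ] f (N ∸ suc t) ≡⟨ cong (f N +_) (∑-reverse N f) ⟩
  f N + ∑[ t < N ] f t           ≡⟨ +-comm (f N) _ ⟩
  ∑[ t < N ] f t + f N           ≡⟨ ∑-snoc N f ⟨
  ∑[ t < suc N ] f t             ∎
  where open ≡-Reasoning

∑-∸ : ∀ N → ∑[ t < N ] (N ∸ t) ≡ ∑[ t < N ] suc t
∑-∸ zero    = refl
∑-∸ (suc N) = trans (∑-cong (suc N) λ { (s≤s t≤N) → +-∸-assoc 1 t≤N }) (∑-reverse (suc N) suc)

∑-pairs : ∀ N (f : ℕ → ℕ) → ∑[ t < 2 * N ] f t ≡ ∑[ i < N ] (f (2 * i) + f (suc (2 * i)))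
∑-pairs zero    f = refl
∑-pairs (suc N) f = begin
  ∑[ t < 2 * suc N ] f t                                         ≡⟨ cong (λ L → ∑< L f) (*-suc 2 N) ⟩
  f 0 + (f 1 + ∑[ t < 2 * N ] f (2 + t))                         ≡⟨ +-assoc (f 0) _ _ ⟨
  (f 0 + f 1) + ∑[ t < 2 * N ] f (2 + t)                         ≡⟨ cong (_ +_) (∑-pairs N _) ⟩
  (f 0 + f 1) + ∑[ i < N ] (f (2 + 2 * i) + f (3 + 2 * i))
    ≡⟨ cong (_ +_) (∑-cong N λ {i} _ → cong₂ (λ x y → f x + f y) (sym (*-suc 2 i)) (cong suc (sym (*-suc 2 i)))) ⟩
  (f 0 + f 1) + ∑[ i < N ] (f (2 * suc i) + f (suc (2 * suc i))) ∎
  where open ≡-Reasoning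

∑-2-periodic : ∀ N (f : ℕ → ℕ) → (∀ t → f (2 + t) ≡ f t) → ∑[ t < 2 * N ] f t ≡ N * (f 0 + f 1)
∑-2-periodic N f periodic =
  trans (∑-pairs N f) (trans (∑-cong N λ {i} _ → cong₂ _+_ (even i) (odd i)) (∑-const N _))
  where
  even : ∀ i → f (2 * i) ≡ f 0
  even zero    = refl
  even (suc i) = trans (cong f (*-suc 2 i)) (trans (periodic (2 * i)) (even i))
  odd : ∀ i → f (suc (2 * i)) ≡ f 1
  odd zero    = refl
  odd (suc i) = trans (cong (f ∘ suc) (*-suc 2 i)) (trans (periodic (suc (2 * i))) (odd i))

gauss : ∀ N → 2 * ∑[ t < N ] suc t ≡ N * suc N
gauss zero    = refl
gauss (suc N) = begin
  2 * ∑[ t < suc N ] suc t         ≡⟨ cong (2 *_) (∑-snoc N suc) ⟩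
  2 * (∑[ t < N ] suc t + suc N)   ≡⟨ *-distribˡ-+ 2 (∑[ t < N ] suc t) (suc N) ⟩
  2 * ∑[ t < N ] suc t + 2 * suc N ≡⟨ cong (_+ 2 * suc N) (gauss N) ⟩
  N * suc N + 2 * suc N            ≡⟨ *-distribʳ-+ (suc N) N 2 ⟨
  (N + 2) * suc N                  ≡⟨ cong (_* suc N) (+-comm N 2) ⟩
  suc (suc N) * suc N              ≡⟨ *-comm (suc (suc N)) (suc N) ⟩
  suc N * suc (suc N)              ∎
  where open ≡-Reasoning

gauss-even : ∀ n → ∑[ t < 2 * n ] suc t ≡ n * suc (2 * n)
gauss-even n = *-cancelˡ-≡ _ _ 2 (trans (gauss (2 * n)) (*-assoc 2 n _))

-- Positions in the edge list of a P₂ ∨ O_m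

nth : {A : Set} → A → List A → ℕ → A
nth d []       t       = d
nth d (x ∷ xs) zero    = x
nth d (x ∷ xs) (suc t) = nth d xs t

module _ {A : Set} (d : A) where

  lookup≡nth : ∀ xs (e : Fin (length xs)) → lookup xs e ≡ nth d xs (toℕ e)
  lookup≡nth (x ∷ xs) fzero    = refl
  lookup≡nth (x ∷ xs) (fsuc e) = lookup≡nth xs e

  nth-++ˡ : ∀ xs {ys t} → t < length xs → nth d (xs ++ ys) t ≡ nth d xs t
  nth-++ˡ (x ∷ xs) {t = zero}  _         = refl
  nth-++ˡ (x ∷ xs) {t = suc t} (s≤s t<) = nth-++ˡ xs t<

  nth-++ʳ : ∀ xs {ys} t → nth d (xs ++ ys) (length xs + t) ≡ nth d ys t
  nth-++ʳ []       t = refl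
  nth-++ʳ (x ∷ xs) t = nth-++ʳ xs t

  nth-applyUpTo : ∀ (f : ℕ → A) N {i} → i < N → nth d (applyUpTo f N) i ≡ f i
  nth-applyUpTo f (suc N) {zero}  _         = refl
  nth-applyUpTo f (suc N) {suc i} (s≤s i<N) = nth-applyUpTo (λ t → f (suc t)) N i<N

  nth-map-upTo : ∀ (f : ℕ → A) N {i} → i < N → nth d (map f (upTo N)) i ≡ f i
  nth-map-upTo f N i<N = trans (cong (λ xs → nth d xs _) (map-applyUpTo (λ t → t) f N)) (nth-applyUpTo f N i<N)

module _ {A B : Set} (F : B → List A) {M} (length-F : ∀ b → length (F b) ≡ M) where

  length-concatMap : ∀ (h : ℕ → B) X → length (concatMap F (applyUpTo h X)) ≡ X * M
  length-concatMap h zero    = refl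
  length-concatMap h (suc X) =
    trans (length-++ (F (h 0))) (cong₂ _+_ (length-F (h 0)) (length-concatMap (λ t → h (suc t)) X))

  nth-concatMap : ∀ d (h : ℕ → B) X {x y} → x < X → y < M →
                  nth d (concatMap F (applyUpTo h X)) (x * M + y) ≡ nth d (F (h x)) y
  nth-concatMap d h (suc X) {zero}  {y} _         y<M = nth-++ˡ d (F (h 0)) (subst (y <_) (sym (length-F (h 0))) y<M)
  nth-concatMap d h (suc X) {suc x} {y} (s≤s x<X) y<M = begin
    nth d (F (h 0) ++ rest) (M + x * M + y)
      ≡⟨ cong (nth d (F (h 0) ++ rest)) (+-assoc M _ y) ⟩
    nth d (F (h 0) ++ rest) (M + (x * M + y))
      ≡⟨ cong (λ L → nth d (F (h 0) ++ rest) (L + _)) (length-F (h 0)) ⟨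
    nth d (F (h 0) ++ rest) (length (F (h 0)) + (x * M + y))
      ≡⟨ nth-++ʳ d (F (h 0)) _ ⟩
    nth d rest (x * M + y)
      ≡⟨ nth-concatMap d (λ t → h (suc t)) X x<X y<M ⟩
    nth d (F (h (suc x))) y ∎
    where
    open ≡-Reasoning
    rest = concatMap F (applyUpTo (λ t → h (suc t)) X)

-- E (matchingJoinNull a m) is, by definition, joinLayout a m (λ i → 2 * i , suc (2 * i)) (λ x y → x , 2 * a + y).
joinLayout : {A : Set} (a m : ℕ) → (ℕ → A) → (ℕ → ℕ → A) → List A
joinLayout a m f g = map f (upTo a) ++ concatMap (λ x → map (g x) (upTo m)) (upTo (2 * a))

divMod : ∀ {X M t} → t < X * M → ∃₂ λ x y → x < X × y < M × t ≡ x * M + y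
divMod {X} {zero}  {t} t< = contradiction (subst (t <_) (*-zeroʳ X) t<) λ ()
divMod {X} {suc M} {t} t< =
  t / suc M , t % suc M , m<n*o⇒m/o<n t< , m%n<n t (suc M) , trans (m≡m%n+[m/n]*n t (suc M)) (+-comm (t % suc M) _)

split-<+ : ∀ a {N t} → t < a + N → t < a ⊎ ∃ λ s → s < N × a + s ≡ t
split-<+ a {N} {t} t< with t <? a
... | yes t<a = inj₁ t<a
... | no  t≮a = inj₂ (t ∸ a , +-cancelˡ-< a _ _ (subst (_< a + N) (sym a+[t∸a]≡t) t<) , a+[t∸a]≡t)
  where a+[t∸a]≡t = m+[n∸m]≡n (≮⇒≥ t≮a)

data JoinPosition (a m : ℕ) : ℕ → Set where
  matching : ∀ {i} → i < a → JoinPosition a m i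
  join     : ∀ {x y} → x < 2 * a → y < m → JoinPosition a m (a + (x * m + y))

joinPosition : ∀ a m {t} → t < a + 2 * a * m → JoinPosition a m t
joinPosition a m t< with split-<+ a t<
... | inj₁ t<a = matching t<a
... | inj₂ (s , s< , refl) with divMod {2 * a} {m} s<
...   | x , y , x< , y< , refl = join x< y<

module _ {A : Set} (d : A) (a m : ℕ) (f : ℕ → A) (g : ℕ → ℕ → A) where

  private
    length-row : ∀ x → length (map (g x) (upTo m)) ≡ m
    length-row x = trans (length-map (g x) (upTo m)) (length-upTo m)

    length-matching : length (map f (upTo a)) ≡ a
    length-matching = trans (length-map f (upTo a)) (length-upTo a)

  length-joinLayout : length (joinLayout a m f g) ≡ a + 2 * a * m
  length-joinLayout = trans (length-++ (map f (upTo a)))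
    (cong₂ _+_ length-matching (length-concatMap (λ x → map (g x) (upTo m)) length-row (λ x → x) (2 * a)))

  nth-joinLayout-matching : ∀ {i} → i < a → nth d (joinLayout a m f g) i ≡ f i
  nth-joinLayout-matching i<a =
    trans (nth-++ˡ d (map f (upTo a)) (subst (_ <_) (sym length-matching) i<a)) (nth-map-upTo d f a i<a)

  nth-joinLayout-join : ∀ {x y} → x < 2 * a → y < m → nth d (joinLayout a m f g) (a + (x * m + y)) ≡ g x y
  nth-joinLayout-join {x} {y} x< y< = begin
    nth d (joinLayout a m f g) (a + (x * m + y))
      ≡⟨ cong (λ L → nth d (joinLayout a m f g) (L + _)) length-matching ⟨
    nth d (joinLayout a m f g) (length (map f (upTo a)) + (x * m + y))
      ≡⟨ nth-++ʳ d (map f (upTo a)) _ ⟩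
    nth d (concatMap (λ x → map (g x) (upTo m)) (upTo (2 * a))) (x * m + y)
      ≡⟨ nth-concatMap _ length-row d (λ x → x) (2 * a) x< y< ⟩
    nth d (map (g x) (upTo m)) y
      ≡⟨ nth-map-upTo d (g x) m y< ⟩
    g x y ∎
    where open ≡-Reasoning

x*m+y<X*m : ∀ {x y X m} → x < X → y < m → x * m + y < X * m
x*m+y<X*m {x} {y} {X} {m} x<X y<m =
  ≤-trans (+-monoʳ-< (x * m) y<m) (≤-trans (≤-reflexive (+-comm (x * m) m)) (*-monoˡ-≤ m x<X))

data EdgeOf (a m : ℕ) : ℕ × ℕ → Set where
  matchingEdge : ∀ {i} → i < a → EdgeOf a m (2 * i , suc (2 * i))
  joinEdge     : ∀ {x y} → x < 2 * a → y < m → EdgeOf a m (x , 2 * a + y)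

edgeOf : ∀ {a m} (e : Fin (q (matchingJoinNull a m))) → EdgeOf a m (edge (matchingJoinNull a m) e)
edgeOf {a} {m} e = subst (EdgeOf a m) (sym (lookup≡nth (0 , 0) (E G) e))
  (at (subst (toℕ e <_) (length-joinLayout (0 , 0) a m _ _) (toℕ<n e)))
  where
  G = matchingJoinNull a m
  at : ∀ {t} → t < a + 2 * a * m → EdgeOf a m (nth (0 , 0) (E G) t)
  at t< with joinPosition a m t<
  ... | matching i<a = subst (EdgeOf a m) (sym (nth-joinLayout-matching (0 , 0) a m _ _ i<a)) (matchingEdge i<a)
  ... | join x< y<   = subst (EdgeOf a m) (sym (nth-joinLayout-join (0 , 0) a m _ _ x< y<)) (joinEdge x< y<)

Adjacent : Graph → ℕ → ℕ → Set
Adjacent G u v = ∃ λ e → edge G e ≡ (u , v)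

module _ {a m : ℕ} where

  private
    G = matchingJoinNull a m

    adjacent-at : ∀ {t p} → (t<q : t < q G) → nth (0 , 0) (E G) t ≡ p → Adjacent G (proj₁ p) (proj₂ p)
    adjacent-at t<q eq = fromℕ< t<q , trans (lookup≡nth (0 , 0) (E G) _) (trans (cong (nth (0 , 0) (E G)) (toℕ-fromℕ< t<q)) eq)

  adjacent-matching : ∀ {i} → i < a → Adjacent G (2 * i) (suc (2 * i))
  adjacent-matching {i} i<a =
    adjacent-at (subst (i <_) (sym (length-joinLayout (0 , 0) a m _ _)) (≤-trans i<a (m≤m+n a _)))
                (nth-joinLayout-matching (0 , 0) a m _ _ i<a)

  adjacent-join : ∀ {x y} → x < 2 * a → y < m → Adjacent G x (2 * a + y)
  adjacent-join {x} {y} x< y< =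
    adjacent-at (subst (a + (x * m + y) <_) (sym (length-joinLayout (0 , 0) a m _ _)) (+-monoʳ-< a (x*m+y<X*m x< y<)))
                (nth-joinLayout-join (0 , 0) a m _ _ x< y<)

-- Labelings from ranks, and their vertex sums

Fin-injective⇒surjective : ∀ {N} (f : Fin N → Fin N) → (∀ {x y} → f x ≡ f y → x ≡ y) → ∀ y → ∃ λ x → f x ≡ y
Fin-injective⇒surjective {suc N} f f-injective y with any? (λ x → f x ≟ᶠ y)
... | yes hit = hit
... | no  miss = contradiction (injective⇒≤ skip-injective) (<-irrefl refl)
  where
  skip : Fin (suc N) → Fin N
  skip x = punchOut {i = y} {j = f x} (λ y≡fx → miss (x , sym y≡fx))
  skip-injective : ∀ {x z} → skip x ≡ skip z → x ≡ z
  skip-injective {x} {z} =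
    f-injective ∘ punchOut-injective {i = y} (λ y≡fx → miss (x , sym y≡fx)) (λ y≡fz → miss (z , sym y≡fz))

module RankLabeling (G : Graph) (rank : ℕ → ℕ)
                    (rank< : ∀ {t} → t < q G → rank t < q G)
                    (rank-injective : ∀ {s t} → s < q G → t < q G → rank s ≡ rank t → s ≡ t) where

  private
    rankFin : Fin (q G) → Fin (q G)
    rankFin e = fromℕ< (rank< (toℕ<n e))

    rankFin-injective : ∀ {e e′} → rankFin e ≡ rankFin e′ → e ≡ e′
    rankFin-injective {e} {e′} eq = toℕ-injective (rank-injective (toℕ<n e) (toℕ<n e′)
      (trans (sym (toℕ-fromℕ< _)) (trans (cong toℕ eq) (toℕ-fromℕ< _))))

    preimage : ∀ e → ∃ λ e′ → rankFin e′ ≡ e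
    preimage = Fin-injective⇒surjective rankFin rankFin-injective

  rankLabeling : Labeling G
  rankLabeling =
    permutation rankFin (proj₁ ∘ preimage) (proj₂ ∘ preimage) (rankFin-injective ∘ proj₂ ∘ preimage ∘ rankFin)

  toℕ-rankLabeling : ∀ e → toℕ (rankLabeling ⟨$⟩ʳ e) ≡ rank (toℕ e)
  toℕ-rankLabeling e = toℕ-fromℕ< _

whenIncident : ℕ → ℕ × ℕ → ℕ → ℕ
whenIncident u e l = if incident u e then l else 0

private
  isYes-refl : ∀ u → ⌊ u ≟ u ⌋ ≡ true
  isYes-refl u = trans (isYes≗does (u ≟ u)) (dec-true (u ≟ u) refl)

  isYes-≢ : ∀ {u x} → u ≢ x → ⌊ u ≟ x ⌋ ≡ false
  isYes-≢ {u} {x} u≢x = trans (isYes≗does (u ≟ x)) (dec-false (u ≟ x) u≢x)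

whenIncident-left : ∀ u v l → whenIncident u (u , v) l ≡ l
whenIncident-left u v l = cong (λ b → if b ∨ ⌊ u ≟ v ⌋ then l else 0) (isYes-refl u)

whenIncident-right : ∀ u v l → whenIncident v (u , v) l ≡ l
whenIncident-right u v l =
  cong (λ b → if b then l else 0) (trans (cong (⌊ v ≟ u ⌋ ∨_) (isYes-refl v)) (∨-zeroʳ ⌊ v ≟ u ⌋))

whenIncident-neither : ∀ {u x y} l → u ≢ x → u ≢ y → whenIncident u (x , y) l ≡ 0
whenIncident-neither l u≢x u≢y = cong₂ (λ b c → if b ∨ c then l else 0) (isYes-≢ u≢x) (isYes-≢ u≢y)

vsum≡∑ : ∀ G (σ : Labeling G) {rank : ℕ → ℕ} → (∀ e → toℕ (σ ⟨$⟩ʳ e) ≡ rank (toℕ e)) → ∀ u →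
         vsum G σ u ≡ ∑[ t < q G ] whenIncident u (nth (0 , 0) (E G) t) (suc (rank t))
vsum≡∑ G σ σ≡rank u = ΣFin≡∑ (q G) λ e → cong₂ (whenIncident u) (lookup≡nth (0 , 0) (E G) e) (cong suc (σ≡rank e))

-- u_i = 2 * i and v_i = suc (2 * i) are the ends of the i-th matching edge; w_y = 2 * a + y.
EndOf : ℕ → ℕ → Set
EndOf i u = u ≡ 2 * i ⊎ u ≡ suc (2 * i)

EndOf-unique : ∀ {i j u} → EndOf i u → EndOf j u → i ≡ j
EndOf-unique {i} {j} (inj₁ refl) (inj₁ 2i≡2j)     = *-cancelˡ-≡ i j 2 2i≡2j
EndOf-unique {i} {j} (inj₁ refl) (inj₂ 2i≡1+2j)   = contradiction 2i≡1+2j (even≢odd i j)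
EndOf-unique {i} {j} (inj₂ refl) (inj₁ 1+2i≡2j)   = contradiction (sym 1+2i≡2j) (even≢odd j i)
EndOf-unique {i} {j} (inj₂ refl) (inj₂ 1+2i≡1+2j) = *-cancelˡ-≡ i j 2 (suc-injective 1+2i≡1+2j)

EndOf-< : ∀ {a i u} → i < a → EndOf i u → u < 2 * a
EndOf-< i<a (inj₁ refl) = *-monoʳ-< 2 i<a
EndOf-< {a} {i} i<a (inj₂ refl) = subst (_≤ 2 * a) (*-suc 2 i) (*-monoʳ-≤ 2 i<a)

half : ∀ {a x} → x < 2 * a → ∃ λ i → i < a × EndOf i x
half {suc a} {zero}        _  = 0 , s≤s z≤n , inj₁ refl
half {suc a} {suc zero}    _  = 0 , s≤s z≤n , inj₂ refl
half {suc a} {suc (suc x)} x< with half {a} {x} (≤-pred (≤-pred (subst (3 + x ≤_) (*-suc 2 a) x<)))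
... | i , i<a , inj₁ refl = suc i , s≤s i<a , inj₁ (sym (*-suc 2 i))
... | i , i<a , inj₂ refl = suc i , s≤s i<a , inj₂ (cong suc (sym (*-suc 2 i)))

module _ {a : ℕ} (f : ℕ → ℕ) where

  ∑-matching-matched : ∀ {i u} → i < a → EndOf i u → ∑[ j < a ] whenIncident u (2 * j , suc (2 * j)) (f j) ≡ f i
  ∑-matching-matched {i} {u} i<a u∈i = trans
    (∑-single a _ i<a λ {j} _ j≢i →
      whenIncident-neither _ (λ u≡2j → j≢i (EndOf-unique (inj₁ u≡2j) u∈i)) (λ u≡1+2j → j≢i (EndOf-unique (inj₂ u≡1+2j) u∈i)))
    (at-end u∈i)
    where
    at-end : EndOf i u → whenIncident u (2 * i , suc (2 * i)) (f i) ≡ f i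
    at-end (inj₁ refl) = whenIncident-left (2 * i) _ _
    at-end (inj₂ refl) = whenIncident-right (2 * i) (suc (2 * i)) _

  ∑-matching-unmatched : ∀ {u} → 2 * a ≤ u → ∑[ j < a ] whenIncident u (2 * j , suc (2 * j)) (f j) ≡ 0
  ∑-matching-unmatched 2a≤u = ∑-zero a _ λ j<a →
    whenIncident-neither _ (>⇒≢ (≤-trans (EndOf-< j<a (inj₁ refl)) 2a≤u)) (>⇒≢ (≤-trans (EndOf-< j<a (inj₂ refl)) 2a≤u))

module _ {a m : ℕ} (g : ℕ → ℕ → ℕ) where

  ∑-join-matched : ∀ {u} → u < 2 * a →
                   ∑[ x < 2 * a ] ∑[ y < m ] whenIncident u (x , 2 * a + y) (g x y) ≡ ∑[ y < m ] g u y
  ∑-join-matched {u} u<2a = trans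
    (∑-single (2 * a) _ u<2a λ _ x≢u → ∑-zero m _ λ {y} _ →
      whenIncident-neither _ (x≢u ∘ sym) (<⇒≢ (≤-trans u<2a (m≤m+n _ y))))
    (∑-cong m λ _ → whenIncident-left u _ _)

  ∑-join-unmatched : ∀ {y} → y < m →
    ∑[ x < 2 * a ] ∑[ y′ < m ] whenIncident (2 * a + y) (x , 2 * a + y′) (g x y′) ≡ ∑[ x < 2 * a ] g x y
  ∑-join-unmatched {y} y<m = ∑-cong (2 * a) λ {x} x<2a → trans
    (∑-single m _ y<m λ _ y′≢y →
      whenIncident-neither _ (>⇒≢ (≤-trans x<2a (m≤m+n _ y))) (y′≢y ∘ sym ∘ +-cancelˡ-≡ (2 * a) _ _))
    (whenIncident-right x (2 * a + y) _)

module _ (a m : ℕ) (rJ : ℕ → ℕ → ℕ) (σ : Labeling (matchingJoinNull a m))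
         (σ≡rank : ∀ e → toℕ (σ ⟨$⟩ʳ e) ≡ nth 0 (joinLayout a m (λ i → i) rJ) (toℕ e)) where

  private
    G = matchingJoinNull a m

  vsum-matchingJoinNull : ∀ u → vsum G σ u ≡
    ∑[ i < a ] whenIncident u (2 * i , suc (2 * i)) (suc i) + ∑[ x < 2 * a ] ∑[ y < m ] whenIncident u (x , 2 * a + y) (suc (rJ x y))
  vsum-matchingJoinNull u = begin
    vsum G σ u
      ≡⟨ vsum≡∑ G σ σ≡rank u ⟩
    ∑[ t < q G ] F t
      ≡⟨ cong (λ L → ∑< L F) (length-joinLayout (0 , 0) a m _ _) ⟩
    ∑[ t < a + 2 * a * m ] F t
      ≡⟨ ∑-+ a (2 * a * m) F ⟩
    ∑[ t < a ] F t + ∑[ t < 2 * a * m ] F (a + t)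
      ≡⟨ cong (∑< a F +_) (∑-* (2 * a) m _) ⟩
    ∑[ t < a ] F t + ∑[ x < 2 * a ] ∑[ y < m ] F (a + (x * m + y))
      ≡⟨ cong₂ _+_ (∑-cong a F-matching) (∑-cong (2 * a) λ x< → ∑-cong m (F-join x<)) ⟩
    ∑[ i < a ] whenIncident u (2 * i , suc (2 * i)) (suc i) + ∑[ x < 2 * a ] ∑[ y < m ] whenIncident u (x , 2 * a + y) (suc (rJ x y)) ∎
    where
    open ≡-Reasoning
    F : ℕ → ℕ
    F t = whenIncident u (nth (0 , 0) (E G) t) (suc (nth 0 (joinLayout a m (λ i → i) rJ) t))
    F-matching : ∀ {i} → i < a → F i ≡ whenIncident u (2 * i , suc (2 * i)) (suc i)
    F-matching i<a = cong₂ (whenIncident u) (nth-joinLayout-matching _ a m _ _ i<a) (cong suc (nth-joinLayout-matching _ a m _ _ i<a))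
    F-join : ∀ {x y} → x < 2 * a → y < m → F (a + (x * m + y)) ≡ whenIncident u (x , 2 * a + y) (suc (rJ x y))
    F-join x< y< = cong₂ (whenIncident u) (nth-joinLayout-join _ a m _ _ x< y<) (cong suc (nth-joinLayout-join _ a m _ _ x< y<))

  vsum-matched : ∀ {i u} → i < a → EndOf i u → vsum G σ u ≡ suc i + ∑[ y < m ] suc (rJ u y)
  vsum-matched {u = u} i<a u∈i = trans (vsum-matchingJoinNull u)
    (cong₂ _+_ (∑-matching-matched {a} suc i<a u∈i) (∑-join-matched {a} {m} (λ x y → suc (rJ x y)) (EndOf-< i<a u∈i)))

  vsum-unmatched : ∀ {y} → y < m → vsum G σ (2 * a + y) ≡ ∑[ x < 2 * a ] suc (rJ x y)
  vsum-unmatched {y} y<m = trans (vsum-matchingJoinNull (2 * a + y))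
    (cong₂ _+_ (∑-matching-unmatched {a} suc (m≤m+n _ y)) (∑-join-unmatched {a} (λ x y → suc (rJ x y)) y<m))

-- Level labelings

divMod-unique : ∀ {a o o′} l l′ → o < a → o′ < a → l * a + o ≡ l′ * a + o′ → l ≡ l′ × o ≡ o′
divMod-unique {suc a′} {o} {o′} l l′ o<a o′<a eq = l≡l′ , o≡o′
  where
  a = suc a′
  o≡o′ : o ≡ o′
  o≡o′ = begin
    o                 ≡⟨ m<n⇒m%n≡m o<a ⟨
    o % a             ≡⟨ [m+kn]%n≡m%n o l a ⟨
    (o + l * a) % a   ≡⟨ cong (_% a) (trans (+-comm o _) (trans eq (+-comm _ o′))) ⟩
    (o′ + l′ * a) % a ≡⟨ [m+kn]%n≡m%n o′ l′ a ⟩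
    o′ % a            ≡⟨ m<n⇒m%n≡m o′<a ⟩
    o′                ∎
    where open ≡-Reasoning
  l≡l′ : l ≡ l′
  l≡l′ = *-cancelʳ-≡ l l′ a (+-cancelʳ-≡ _ _ _ (trans eq (cong (l′ * a +_) (sym o≡o′))))

interleave : {A : Set} → (ℕ → A) → (ℕ → A) → ℕ → A
interleave f g zero          = f 0
interleave f g (suc zero)    = g 0
interleave f g (suc (suc x)) = interleave (f ∘ suc) (g ∘ suc) x

interleave-even : ∀ {A : Set} (f g : ℕ → A) i → interleave f g (2 * i) ≡ f i
interleave-even f g zero    = refl
interleave-even f g (suc i) = trans (cong (interleave f g) (*-suc 2 i)) (interleave-even (f ∘ suc) (g ∘ suc) i)

interleave-odd : ∀ {A : Set} (f g : ℕ → A) i → interleave f g (suc (2 * i)) ≡ g i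
interleave-odd f g zero    = refl
interleave-odd f g (suc i) = trans (cong (interleave f g ∘ suc) (*-suc 2 i)) (interleave-odd (f ∘ suc) (g ∘ suc) i)

record PermutesBelow (a : ℕ) (f : ℕ → ℕ) : Set where
  field
    bounded   : ∀ {i} → i < a → f i < a
    injective : ∀ {i j} → i < a → j < a → f i ≡ f j → i ≡ j

module _ {a m : ℕ} {rJ : ℕ → ℕ → ℕ}
         (rJ-bounds : ∀ {x y} → x < 2 * a → y < m → a ≤ rJ x y × rJ x y < a + 2 * a * m)
         (rJ-injective : ∀ {x y x′ y′} → x < 2 * a → y < m → x′ < 2 * a → y′ < m →
                         rJ x y ≡ rJ x′ y′ → x ≡ x′ × y ≡ y′) where

  private
    rank : ℕ → ℕ
    rank = nth 0 (joinLayout a m (λ i → i) rJ)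

    rank-matching : ∀ {i} → i < a → rank i ≡ i
    rank-matching = nth-joinLayout-matching 0 a m _ rJ

    rank-join : ∀ {x y} → x < 2 * a → y < m → rank (a + (x * m + y)) ≡ rJ x y
    rank-join = nth-joinLayout-join 0 a m _ rJ

  joinLayout-rank< : ∀ {t} → t < a + 2 * a * m → rank t < a + 2 * a * m
  joinLayout-rank< t< with joinPosition a m t<
  ... | matching i<a  = subst (_< _) (sym (rank-matching i<a)) t<
  ... | join x<2a y<m = subst (_< _) (sym (rank-join x<2a y<m)) (proj₂ (rJ-bounds x<2a y<m))

  joinLayout-rank-injective : ∀ {s t} → s < a + 2 * a * m → t < a + 2 * a * m → rank s ≡ rank t → s ≡ t
  joinLayout-rank-injective s< t< eq with joinPosition a m s< | joinPosition a m t<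
  ... | matching i<a | matching j<a = trans (sym (rank-matching i<a)) (trans eq (rank-matching j<a))
  ... | matching i<a | join x< y< =
    contradiction (trans (sym (rank-matching i<a)) (trans eq (rank-join x< y<))) (<⇒≢ (<-≤-trans i<a (proj₁ (rJ-bounds x< y<))))
  ... | join x< y< | matching j<a =
    contradiction (trans (sym (rank-matching j<a)) (trans (sym eq) (rank-join x< y<))) (<⇒≢ (<-≤-trans j<a (proj₁ (rJ-bounds x< y<))))
  ... | join x< y< | join x′< y′<
    with rJ-injective x< y< x′< y′< (trans (sym (rank-join x< y<)) (trans eq (rank-join x′< y′<)))
  ...   | refl , refl = refl

-- Ranks are labels minus one; the level 2m - y of v_i w_y is written m + (m ∸ y).
module LevelLabeling (a m : ℕ) (α β : ℕ → ℕ → ℕ)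
                     (α-perm : ∀ {y} → y < m → PermutesBelow a (α y))
                     (β-perm : ∀ {y} → y < m → PermutesBelow a (β y)) where

  open PermutesBelow

  uRank vRank : ℕ → ℕ → ℕ
  uRank i y = suc y * a + α y i
  vRank i y = (m + (m ∸ y)) * a + β y i

  joinRank : ℕ → ℕ → ℕ
  joinRank = interleave uRank vRank

  joinRank-u : ∀ i y → joinRank (2 * i) y ≡ uRank i y
  joinRank-u i y = cong (λ f → f y) (interleave-even uRank vRank i)

  joinRank-v : ∀ i y → joinRank (suc (2 * i)) y ≡ vRank i y
  joinRank-v i y = cong (λ f → f y) (interleave-odd uRank vRank i)

  level-bounds : ∀ {l o} → 1 ≤ l → l ≤ m + m → o < a → a ≤ l * a + o × l * a + o < a + 2 * a * m
  level-bounds {suc l} {o} _ l≤2m o<a = ≤-trans (m≤m+n a (l * a)) (m≤m+n _ o) , (begin-strict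
    suc l * a + o   <⟨ +-monoʳ-< (suc l * a) o<a ⟩
    suc l * a + a   ≤⟨ +-monoˡ-≤ a (*-monoˡ-≤ a l≤2m) ⟩
    (m + m) * a + a ≡⟨ lemma a m ⟩
    a + 2 * a * m   ∎)
    where
    open ≤-Reasoning
    lemma : ∀ a m → (m + m) * a + a ≡ a + 2 * a * m
    lemma = solve-∀

  u-level≢v-level : ∀ {y y′} → y < m → y′ < m → suc y ≢ m + (m ∸ y′)
  u-level≢v-level {y′ = y′} y<m y′<m =
    <⇒≢ (≤-trans (s≤s y<m) (subst (_≤ m + (m ∸ y′)) (+-comm m 1) (+-monoʳ-≤ m (m<n⇒0<n∸m y′<m))))

  joinRank-bounds : ∀ {x y} → x < 2 * a → y < m → a ≤ joinRank x y × joinRank x y < a + 2 * a * m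
  joinRank-bounds {y = y} x<2a y<m with half {a} x<2a
  ... | i , i<a , inj₁ refl = subst (λ r → a ≤ r × r < a + 2 * a * m) (sym (joinRank-u i y))
    (level-bounds (s≤s z≤n) (≤-trans y<m (m≤m+n m m)) (bounded (α-perm y<m) i<a))
  ... | i , i<a , inj₂ refl = subst (λ r → a ≤ r × r < a + 2 * a * m) (sym (joinRank-v i y))
    (level-bounds (≤-trans (m<n⇒0<n∸m y<m) (m≤n+m _ m)) (+-monoʳ-≤ m (m∸n≤m m y)) (bounded (β-perm y<m) i<a))

  joinRank-injective : ∀ {x y x′ y′} → x < 2 * a → y < m → x′ < 2 * a → y′ < m →
                       joinRank x y ≡ joinRank x′ y′ → x ≡ x′ × y ≡ y′
  joinRank-injective {y = y} {y′ = y′} x<2a y<m x′<2a y′<m eq with half {a} x<2a | half {a} x′<2a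
  ... | i , i<a , inj₁ refl | j , j<a , inj₁ refl
    with divMod-unique (suc y) (suc y′) (bounded (α-perm y<m) i<a) (bounded (α-perm y′<m) j<a)
                       (trans (sym (joinRank-u i y)) (trans eq (joinRank-u j y′)))
  ...   | refl , α≡ = cong (2 *_) (injective (α-perm y<m) i<a j<a α≡) , refl
  joinRank-injective {y = y} {y′ = y′} x<2a y<m x′<2a y′<m eq | i , i<a , inj₂ refl | j , j<a , inj₂ refl
    with divMod-unique (m + (m ∸ y)) (m + (m ∸ y′)) (bounded (β-perm y<m) i<a) (bounded (β-perm y′<m) j<a)
                       (trans (sym (joinRank-v i y)) (trans eq (joinRank-v j y′)))
  ...   | level≡ , β≡ with ∸-cancelˡ-≡ (<⇒≤ y<m) (<⇒≤ y′<m) (+-cancelˡ-≡ m _ _ level≡)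
  ...     | refl = cong (suc ∘ (2 *_)) (injective (β-perm y<m) i<a j<a β≡) , refl
  joinRank-injective {y = y} {y′ = y′} x<2a y<m x′<2a y′<m eq | i , i<a , inj₁ refl | j , j<a , inj₂ refl =
    contradiction (proj₁ (divMod-unique (suc y) (m + (m ∸ y′)) (bounded (α-perm y<m) i<a) (bounded (β-perm y′<m) j<a)
                                        (trans (sym (joinRank-u i y)) (trans eq (joinRank-v j y′)))))
                  (u-level≢v-level y<m y′<m)
  joinRank-injective {y = y} {y′ = y′} x<2a y<m x′<2a y′<m eq | i , i<a , inj₂ refl | j , j<a , inj₁ refl =
    contradiction (sym (proj₁ (divMod-unique (m + (m ∸ y)) (suc y′) (bounded (β-perm y<m) i<a) (bounded (α-perm y′<m) j<a)
                                             (trans (sym (joinRank-v i y)) (trans eq (joinRank-u j y′))))))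
                  (u-level≢v-level y′<m y<m)

  rank : ℕ → ℕ
  rank = nth 0 (joinLayout a m (λ i → i) joinRank)

  open RankLabeling (matchingJoinNull a m) rank
    (subst (λ Q → ∀ {t} → t < Q → rank t < Q) (sym (length-joinLayout (0 , 0) a m _ _))
           (joinLayout-rank< joinRank-bounds joinRank-injective))
    (subst (λ Q → ∀ {s t} → s < Q → t < Q → rank s ≡ rank t → s ≡ t) (sym (length-joinLayout (0 , 0) a m _ _))
           (joinLayout-rank-injective joinRank-bounds joinRank-injective))
    public

  private
    G = matchingJoinNull a m
    σ = rankLabeling

    regroup : ∀ i m L S → suc i + (m + (L + S)) ≡ suc (m + L + (i + S))
    regroup = solve-∀

  vsum-u : ∀ {i} → i < a → vsum G σ (2 * i) ≡ suc (m + ∑[ y < m ] suc y * a + (i + ∑[ y < m ] α y i))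
  vsum-u {i} i<a = begin
    vsum G σ (2 * i)
      ≡⟨ vsum-matched a m joinRank σ toℕ-rankLabeling i<a (inj₁ refl) ⟩
    suc i + ∑[ y < m ] suc (joinRank (2 * i) y)
      ≡⟨ cong (suc i +_) (∑-cong m λ {y} _ → cong suc (joinRank-u i y)) ⟩
    suc i + ∑[ y < m ] suc (suc y * a + α y i)
      ≡⟨ cong (suc i +_) (∑-suc m _) ⟩
    suc i + (m + ∑[ y < m ] (suc y * a + α y i))
      ≡⟨ cong (λ s → suc i + (m + s)) (∑-distrib-+ m _ _) ⟩
    suc i + (m + (∑[ y < m ] (suc y * a) + ∑[ y < m ] α y i))
      ≡⟨ cong (λ s → suc i + (m + (s + _))) (∑-distribʳ-* m suc a) ⟩
    suc i + (m + (∑[ y < m ] suc y * a + ∑[ y < m ] α y i))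
      ≡⟨ regroup i m _ _ ⟩
    suc (m + ∑[ y < m ] suc y * a + (i + ∑[ y < m ] α y i)) ∎
    where open ≡-Reasoning

  vsum-v : ∀ {i} → i < a → vsum G σ (suc (2 * i)) ≡ suc (m + (m * m + ∑[ y < m ] suc y) * a + (i + ∑[ y < m ] β y i))
  vsum-v {i} i<a = begin
    vsum G σ (suc (2 * i))
      ≡⟨ vsum-matched a m joinRank σ toℕ-rankLabeling i<a (inj₂ refl) ⟩
    suc i + ∑[ y < m ] suc (joinRank (suc (2 * i)) y)
      ≡⟨ cong (suc i +_) (∑-cong m λ {y} _ → cong suc (joinRank-v i y)) ⟩
    suc i + ∑[ y < m ] suc ((m + (m ∸ y)) * a + β y i)
      ≡⟨ cong (suc i +_) (∑-suc m _) ⟩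
    suc i + (m + ∑[ y < m ] ((m + (m ∸ y)) * a + β y i))
      ≡⟨ cong (λ s → suc i + (m + s)) (∑-distrib-+ m _ _) ⟩
    suc i + (m + (∑[ y < m ] ((m + (m ∸ y)) * a) + ∑[ y < m ] β y i))
      ≡⟨ cong (λ s → suc i + (m + (s + _))) (∑-distribʳ-* m _ a) ⟩
    suc i + (m + (∑[ y < m ] (m + (m ∸ y)) * a + ∑[ y < m ] β y i))
      ≡⟨ cong (λ s → suc i + (m + (s * a + ∑[ y < m ] β y i))) levels ⟩
    suc i + (m + ((m * m + ∑[ y < m ] suc y) * a + ∑[ y < m ] β y i))
      ≡⟨ regroup i m _ _ ⟩
    suc (m + (m * m + ∑[ y < m ] suc y) * a + (i + ∑[ y < m ] β y i)) ∎
    where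
    open ≡-Reasoning
    levels : ∑[ y < m ] (m + (m ∸ y)) ≡ m * m + ∑[ y < m ] suc y
    levels = trans (∑-distrib-+ m (λ _ → m) (m ∸_)) (cong₂ _+_ (∑-const m m) (∑-∸ m))

  vsum-w : ∀ {y} → y < m → vsum G σ (2 * a + y) ≡ a * (2 + suc (m + m) * a) + ∑[ i < a ] (α y i + β y i)
  vsum-w {y} y<m = begin
    vsum G σ (2 * a + y)
      ≡⟨ vsum-unmatched a m joinRank σ toℕ-rankLabeling y<m ⟩
    ∑[ x < 2 * a ] suc (joinRank x y)
      ≡⟨ ∑-pairs a _ ⟩
    ∑[ i < a ] (suc (joinRank (2 * i) y) + suc (joinRank (suc (2 * i)) y))
      ≡⟨ ∑-cong a (λ {i} _ → cong₂ (λ r s → suc r + suc s) (joinRank-u i y) (joinRank-v i y)) ⟩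
    ∑[ i < a ] (suc (uRank i y) + suc (vRank i y))
      ≡⟨ ∑-cong a (λ {i} _ → column i) ⟩
    ∑[ i < a ] ((2 + suc (m + m) * a) + (α y i + β y i))
      ≡⟨ ∑-distrib-+ a _ _ ⟩
    ∑[ i < a ] (2 + suc (m + m) * a) + ∑[ i < a ] (α y i + β y i)
      ≡⟨ cong (_+ _) (∑-const a _) ⟩
    a * (2 + suc (m + m) * a) + ∑[ i < a ] (α y i + β y i) ∎
    where
    open ≡-Reasoning
    regroup₂ : ∀ l l′ a p q → suc (l * a + p) + suc (l′ * a + q) ≡ 2 + (l + l′) * a + (p + q)
    regroup₂ = solve-∀
    shuffle : ∀ y m d → suc y + (m + d) ≡ suc (m + (y + d))
    shuffle = solve-∀
    levels : suc y + (m + (m ∸ y)) ≡ suc (m + m)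
    levels = trans (shuffle y m (m ∸ y)) (cong (λ z → suc (m + z)) (m+[n∸m]≡n (<⇒≤ y<m)))
    column : ∀ i → suc (uRank i y) + suc (vRank i y) ≡ (2 + suc (m + m) * a) + (α y i + β y i)
    column i = trans (regroup₂ (suc y) (m + (m ∸ y)) a _ _) (cong (λ l → 2 + l * a + (α y i + β y i)) levels)

-- A magic rectangle

module MagicOffsets (k : ℕ) where

  a : ℕ
  a = 2 * k + 1

  -- For i < a the triples (i , shift i , third i) are the columns of a magic rectangle:
  -- each row permutes 0 … 2k and each column sums to 3k.
  shift : ℕ → ℕ
  shift i with i ≤? k
  ... | yes _ = k + i
  ... | no  _ = i ∸ suc k

  third : ℕ → ℕ
  third i with i ≤? k
  ... | yes _ = 2 * k ∸ 2 * i
  ... | no  _ = 4 * k + 1 ∸ 2 * i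

  data Side (i : ℕ) : Set where
    low  : ∀ r → i + r ≡ k → Side i
    high : ∀ j s → suc (j + s) ≡ k → suc k + j ≡ i → Side i

  side : ∀ {i} → i < a → Side i
  side {i} i<a with i ≤? k
  ... | yes i≤k = low (k ∸ i) (m+[n∸m]≡n i≤k)
  ... | no  i≰k = high j (k ∸ suc j) (m+[n∸m]≡n j<k) i≡
    where
    j = i ∸ suc k
    i≡ : suc k + j ≡ i
    i≡ = m+[n∸m]≡n (≰⇒> i≰k)
    j<k : j < k
    j<k = +-cancelˡ-≤ (suc k) _ _ (begin
      suc k + suc j   ≡⟨ +-suc (suc k) j ⟩
      suc (suc k + j) ≡⟨ cong suc i≡ ⟩
      suc i           ≤⟨ i<a ⟩
      2 * k + 1       ≡⟨ lemma k ⟩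
      suc k + k       ∎)
      where
      open ≤-Reasoning
      lemma : ∀ k → 2 * k + 1 ≡ suc k + k
      lemma = solve-∀

  shift-low : ∀ {i r} → i + r ≡ k → shift i ≡ k + i
  shift-low {i} {r} e with i ≤? k
  ... | yes _   = refl
  ... | no  i≰k = contradiction (subst (i ≤_) e (m≤m+n i r)) i≰k

  shift-high : ∀ {i j s} → suc (j + s) ≡ k → suc k + j ≡ i → shift i ≡ j
  shift-high {i} {j} _ f with i ≤? k
  ... | yes i≤k = contradiction (subst (_≤ k) (sym f) i≤k) (<⇒≱ (m≤m+n (suc k) j))
  ... | no  _   = trans (cong (_∸ suc k) (sym f)) (m+n∸m≡n (suc k) j)

  third-low : ∀ {i r} → i + r ≡ k → third i ≡ 2 * r
  third-low {i} {r} e with i ≤? k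
  ... | yes _   = trans (cong (λ K → 2 * K ∸ 2 * i) (sym e)) (trans (cong (_∸ 2 * i) (*-distribˡ-+ 2 i r)) (m+n∸m≡n (2 * i) (2 * r)))
  ... | no  i≰k = contradiction (subst (i ≤_) e (m≤m+n i r)) i≰k

  third-high : ∀ {i j s} → suc (j + s) ≡ k → suc k + j ≡ i → third i ≡ suc (2 * s)
  third-high {i} {j} {s} e f with i ≤? k
  ... | yes i≤k = contradiction (subst (_≤ k) (sym f) i≤k) (<⇒≱ (m≤m+n (suc k) j))
  ... | no  _   = trans (cong (_∸ 2 * i) split) (m+n∸m≡n (2 * i) _)
    where
    open ≡-Reasoning
    lemma₁ : ∀ k → 4 * k + 1 ≡ 2 * k + 2 * k + 1
    lemma₁ = solve-∀
    lemma₂ : ∀ k j s → 2 * k + 2 * suc (j + s) + 1 ≡ 2 * (suc k + j) + suc (2 * s)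
    lemma₂ = solve-∀
    split : 4 * k + 1 ≡ 2 * i + suc (2 * s)
    split = begin
      4 * k + 1                    ≡⟨ lemma₁ k ⟩
      2 * k + 2 * k + 1            ≡⟨ cong (λ K → 2 * k + 2 * K + 1) (sym e) ⟩
      2 * k + 2 * suc (j + s) + 1  ≡⟨ lemma₂ k j s ⟩
      2 * (suc k + j) + suc (2 * s) ≡⟨ cong (λ I → 2 * I + suc (2 * s)) f ⟩
      2 * i + suc (2 * s)          ∎

  magic : ∀ {i} → i < a → i + shift i + third i ≡ 3 * k
  magic {i} i<a with side i<a
  ... | low r e = trans (cong₂ (λ y z → i + y + z) (shift-low {i} e) (third-low {i} e))
                        (subst (λ K → i + (K + i) + 2 * r ≡ 3 * K) e (lemma i r))
    where
    lemma : ∀ i r → i + ((i + r) + i) + 2 * r ≡ 3 * (i + r)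
    lemma = solve-∀
  ... | high j s e f = trans (cong₂ (λ y z → i + y + z) (shift-high {i} e f) (third-high {i} e f))
                             (subst (λ I → I + j + suc (2 * s) ≡ 3 * k) f
                               (subst (λ K → suc K + j + j + suc (2 * s) ≡ 3 * K) e (lemma j s)))
    where
    lemma : ∀ j s → suc (suc (j + s)) + j + j + suc (2 * s) ≡ 3 * suc (j + s)
    lemma = solve-∀

  ≤2k⇒<a : ∀ {x} → x ≤ 2 * k → x < a
  ≤2k⇒<a {x} x≤2k = subst (x <_) (+-comm 1 (2 * k)) (s≤s x≤2k)

  <a⇒≤2k : ∀ {x} → x < a → x ≤ 2 * k
  <a⇒≤2k {x} x<a = ≤-pred (subst (suc x ≤_) (+-comm (2 * k) 1) x<a)

  private
    k+k≡2k : k + k ≡ 2 * k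
    k+k≡2k = cong (k +_) (sym (+-identityʳ k))

    low≤k : ∀ {i r} → i + r ≡ k → i ≤ k
    low≤k {i} {r} e = subst (i ≤_) e (m≤m+n i r)

    high-j<k : ∀ {j s} → suc (j + s) ≡ k → j < k
    high-j<k {j} {s} e = subst (j <_) e (s≤s (m≤m+n j s))

    high-s<k : ∀ {j s} → suc (j + s) ≡ k → s < k
    high-s<k {j} {s} e = subst (s <_) e (s≤s (m≤n+m s j))

  shift-bounded : ∀ {i} → i < a → shift i < a
  shift-bounded {i} i<a with side i<a
  ... | low r e      = subst (_< a) (sym (shift-low {i} e)) (≤2k⇒<a (subst (k + i ≤_) k+k≡2k (+-monoʳ-≤ k (low≤k e))))
  ... | high j s e f = subst (_< a) (sym (shift-high {i} e f)) (≤2k⇒<a (≤-trans (<⇒≤ (high-j<k e)) (m≤m+n k _)))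

  shift-injective : ∀ {i i′} → i < a → i′ < a → shift i ≡ shift i′ → i ≡ i′
  shift-injective {i} {i′} i<a i′<a eq with side i<a | side i′<a
  ... | low r e | low r′ e′ = +-cancelˡ-≡ k i i′ (trans (sym (shift-low {i} e)) (trans eq (shift-low {i′} e′)))
  ... | high j s e f | high j′ s′ e′ f′ =
    trans (sym f) (trans (cong (suc k +_) (trans (sym (shift-high {i} e f)) (trans eq (shift-high {i′} e′ f′)))) f′)
  ... | low r e | high j′ s′ e′ f′ =
    contradiction (trans (sym (shift-low {i} e)) (trans eq (shift-high {i′} e′ f′))) (>⇒≢ (<-≤-trans (high-j<k e′) (m≤m+n k i)))
  ... | high j s e f | low r′ e′ =
    contradiction (trans (sym (shift-low {i′} e′)) (trans (sym eq) (shift-high {i} e f))) (>⇒≢ (<-≤-trans (high-j<k e) (m≤m+n k i′)))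

  third-bounded : ∀ {i} → i < a → third i < a
  third-bounded {i} i<a with side i<a
  ... | low r e      = subst (_< a) (sym (third-low {i} e)) (≤2k⇒<a (*-monoʳ-≤ 2 (subst (r ≤_) e (m≤n+m r i))))
  ... | high j s e f = subst (_< a) (sym (third-high {i} e f))
                         (≤2k⇒<a (≤-trans (n≤1+n _) (subst (_≤ 2 * k) (*-suc 2 s) (*-monoʳ-≤ 2 (high-s<k e)))))

  third-injective : ∀ {i i′} → i < a → i′ < a → third i ≡ third i′ → i ≡ i′
  third-injective {i} {i′} i<a i′<a eq with side i<a | side i′<a
  ... | low r e | low r′ e′ =
    let r≡r′ = *-cancelˡ-≡ r r′ 2 (trans (sym (third-low {i} e)) (trans eq (third-low {i′} e′)))
    in +-cancelʳ-≡ r i i′ (trans (trans e (sym e′)) (cong (i′ +_) (sym r≡r′)))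
  ... | high j s e f | high j′ s′ e′ f′ =
    let s≡s′ = *-cancelˡ-≡ s s′ 2 (suc-injective (trans (sym (third-high {i} e f)) (trans eq (third-high {i′} e′ f′))))
        j≡j′ = +-cancelʳ-≡ s j j′ (suc-injective (trans (trans e (sym e′)) (cong (λ t → suc (j′ + t)) (sym s≡s′))))
    in trans (sym f) (trans (cong (suc k +_) j≡j′) f′)
  ... | low r e | high j′ s′ e′ f′ =
    contradiction (trans (sym (third-low {i} e)) (trans eq (third-high {i′} e′ f′))) (even≢odd r s′)
  ... | high j s e f | low r′ e′ =
    contradiction (trans (sym (third-low {i′} e′)) (trans (sym eq) (third-high {i} e f))) (even≢odd r′ s)

  alternating : ℕ → ℕ → ℕ
  alternating zero          i = i
  alternating (suc zero)    i = 2 * k ∸ i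
  alternating (suc (suc y)) i = alternating y i

  alternating-bounded : ∀ y {i} → i < a → alternating y i < a
  alternating-bounded zero          i<a = i<a
  alternating-bounded (suc zero) {i} _ = ≤2k⇒<a (m∸n≤m (2 * k) i)
  alternating-bounded (suc (suc y)) i<a = alternating-bounded y i<a

  alternating-injective : ∀ y {i i′} → i < a → i′ < a → alternating y i ≡ alternating y i′ → i ≡ i′
  alternating-injective zero          _   _    eq = eq
  alternating-injective (suc zero)    i<a i′<a eq = ∸-cancelˡ-≡ (<a⇒≤2k i<a) (<a⇒≤2k i′<a) eq
  alternating-injective (suc (suc y)) i<a i′<a eq = alternating-injective y i<a i′<a eq

  alternating-pair : ∀ y {i} → i < a → alternating y i + alternating (suc y) i ≡ 2 * k
  alternating-pair zero          i<a = m+[n∸m]≡n (<a⇒≤2k i<a)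
  alternating-pair (suc zero)    i<a = m∸n+n≡m (<a⇒≤2k i<a)
  alternating-pair (suc (suc y)) i<a = alternating-pair y i<a

  -- The first two levels use the magic rectangle; on the remaining ones the offsets alternate
  -- between i and 2k ∸ i, so that consecutive levels contribute 2k to every row and column.
  α β : ℕ → ℕ → ℕ
  α zero          = shift
  α (suc zero)    = third
  α (suc (suc y)) = alternating y
  β zero          = third
  β (suc zero)    = shift
  β (suc (suc y)) = alternating (suc y)

  α-perm : ∀ y → PermutesBelow a (α y)
  α-perm zero          = record { bounded = shift-bounded ; injective = shift-injective }
  α-perm (suc zero)    = record { bounded = third-bounded ; injective = third-injective }
  α-perm (suc (suc y)) = record { bounded = alternating-bounded y ; injective = alternating-injective y }

  β-perm : ∀ y → PermutesBelow a (β y)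
  β-perm zero          = record { bounded = third-bounded ; injective = third-injective }
  β-perm (suc zero)    = record { bounded = shift-bounded ; injective = shift-injective }
  β-perm (suc (suc y)) = record { bounded = alternating-bounded (suc y) ; injective = alternating-injective (suc y) }

  private
    regroup : ∀ i p q r → i + (p + (q + r)) ≡ i + p + q + r
    regroup = solve-∀

    regroup′ : ∀ i p q r → i + (q + (p + r)) ≡ i + p + q + r
    regroup′ = solve-∀

    rows : ∀ k n′ → 3 * k + n′ * (2 * k) ≡ k * suc (2 * suc n′)
    rows = solve-∀

  α-row : ∀ {n i} → 1 ≤ n → i < a → i + ∑[ y < 2 * n ] α y i ≡ k * suc (2 * n)
  α-row {suc n′} {i} _ i<a = begin
    i + ∑[ y < 2 * suc n′ ] α y i
      ≡⟨ cong (λ N → i + ∑< N (λ y → α y i)) (*-suc 2 n′) ⟩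
    i + (shift i + (third i + ∑[ y < 2 * n′ ] alternating y i))
      ≡⟨ cong (λ z → i + (shift i + (third i + z))) alternation ⟩
    i + (shift i + (third i + n′ * (2 * k)))
      ≡⟨ regroup i _ _ _ ⟩
    i + shift i + third i + n′ * (2 * k)
      ≡⟨ cong (_+ n′ * (2 * k)) (magic i<a) ⟩
    3 * k + n′ * (2 * k)
      ≡⟨ rows k n′ ⟩
    k * suc (2 * suc n′) ∎
    where
    open ≡-Reasoning
    alternation : ∑[ y < 2 * n′ ] alternating y i ≡ n′ * (2 * k)
    alternation = trans (∑-2-periodic n′ (λ y → alternating y i) (λ _ → refl)) (cong (n′ *_) (alternating-pair 0 i<a))

  β-row : ∀ {n i} → 1 ≤ n → i < a → i + ∑[ y < 2 * n ] β y i ≡ k * suc (2 * n)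
  β-row {suc n′} {i} _ i<a = begin
    i + ∑[ y < 2 * suc n′ ] β y i
      ≡⟨ cong (λ N → i + ∑< N (λ y → β y i)) (*-suc 2 n′) ⟩
    i + (third i + (shift i + ∑[ y < 2 * n′ ] alternating (suc y) i))
      ≡⟨ cong (λ z → i + (third i + (shift i + z))) alternation ⟩
    i + (third i + (shift i + n′ * (2 * k)))
      ≡⟨ regroup′ i _ _ _ ⟩
    i + shift i + third i + n′ * (2 * k)
      ≡⟨ cong (_+ n′ * (2 * k)) (magic i<a) ⟩
    3 * k + n′ * (2 * k)
      ≡⟨ rows k n′ ⟩
    k * suc (2 * suc n′) ∎
    where
    open ≡-Reasoning
    alternation : ∑[ y < 2 * n′ ] alternating (suc y) i ≡ n′ * (2 * k)
    alternation = trans (∑-2-periodic n′ (λ y → alternating (suc y) i) (λ _ → refl)) (cong (n′ *_) (alternating-pair 1 i<a))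

  ∑-index : ∑[ i < a ] i ≡ k * a
  ∑-index = begin
    ∑[ i < 2 * k + 1 ] i     ≡⟨ cong (λ N → ∑< N (λ i → i)) (+-comm (2 * k) 1) ⟩
    ∑[ t < 2 * k ] suc t     ≡⟨ gauss-even k ⟩
    k * suc (2 * k)          ≡⟨ cong (k *_) (+-comm 1 (2 * k)) ⟩
    k * a                    ∎
    where open ≡-Reasoning

  ∑-shift+third : ∑[ i < a ] (shift i + third i) ≡ a * (2 * k)
  ∑-shift+third = +-cancelˡ-≡ (∑[ i < a ] i) _ _ (begin
    ∑[ i < a ] i + ∑[ i < a ] (shift i + third i) ≡⟨ ∑-distrib-+ a (λ i → i) _ ⟨
    ∑[ i < a ] (i + (shift i + third i))          ≡⟨ ∑-cong a (λ {i} i<a → trans (sym (+-assoc i _ _)) (magic i<a)) ⟩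
    ∑[ i < a ] (3 * k)                            ≡⟨ ∑-const a (3 * k) ⟩
    a * (3 * k)                                   ≡⟨ lemma k ⟩
    k * a + a * (2 * k)                           ≡⟨ cong (_+ a * (2 * k)) ∑-index ⟨
    ∑[ i < a ] i + a * (2 * k)                    ∎)
    where
    open ≡-Reasoning
    lemma : ∀ k → (2 * k + 1) * (3 * k) ≡ k * (2 * k + 1) + (2 * k + 1) * (2 * k)
    lemma = solve-∀

  column : ∀ y → ∑[ i < a ] (α y i + β y i) ≡ a * (2 * k)
  column zero          = ∑-shift+third
  column (suc zero)    = trans (∑-cong a λ {i} _ → +-comm (third i) (shift i)) ∑-shift+third
  column (suc (suc y)) = trans (∑-cong a (alternating-pair y)) (∑-const a (2 * k))

-- The three vertex sums

1+a*x≢a*y : ∀ {a} x y → 2 ≤ a → suc (a * x) ≢ a * y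
1+a*x≢a*y {a} x y 2≤a eq = contradiction (∣1⇒≡1 a∣1) (>⇒≢ 2≤a)
  where
  a∣1 : a ∣ 1
  a∣1 = ∣m+n∣m⇒∣n (subst (a ∣_) (trans (sym eq) (+-comm 1 (a * x))) (m∣m*n y)) (m∣m*n x)

-- c = 1 + a p would divide 2 a, which is smaller than c.
p*[1+a*p]≢2a*[2a*p+1] : ∀ {a p} → 1 ≤ a → 2 ≤ p → p * (1 + a * p) ≢ 2 * a * (2 * a * p + 1)
p*[1+a*p]≢2a*[2a*p+1] {suc a′} {p} _ 2≤p eq = contradiction (∣⇒≤ c∣2a) (<⇒≱ 2a<c)
  where
  a = suc a′
  c = 1 + a * p
  lemma : ∀ a p → 2 * a * (2 * a * p + 1) + 2 * a ≡ (4 * a) * (1 + a * p)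
  lemma = solve-∀
  c∣2a : c ∣ 2 * a
  c∣2a = ∣m+n∣m⇒∣n (subst (c ∣_) (sym (trans (cong (_+ 2 * a) eq) (lemma a p))) (n∣m*n (4 * a))) (n∣m*n p)
  2a<c : 2 * a < c
  2a<c = s≤s (subst (_≤ a * p) (*-comm a 2) (*-monoʳ-≤ a 2≤p))

uColour vColour wColour : ℕ → ℕ → ℕ
uColour n k = suc (2 * n) * (suc k + (2 * k + 1) * n)
vColour n k = suc (2 * n) * suc k + (2 * k + 1) * (n * (6 * n + 1))
wColour n k = (2 * k + 1) * (1 + 2 * (2 * k + 1) * suc (2 * n))

-- vColour n k = uColour n k + 4 (2k + 1) n², displayed as a successor.
uColour≢vColour : ∀ {n} k → 1 ≤ n → uColour n k ≢ vColour n k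
uColour≢vColour {suc n′} k _ eq = m≢1+m+n (uColour (suc n′) k) (trans eq (lemma n′ k))
  where
  lemma : ∀ n′ k → suc (2 * suc n′) * suc k + (2 * k + 1) * (suc n′ * (6 * suc n′ + 1))
                   ≡ suc (suc (2 * suc n′) * (suc k + (2 * k + 1) * suc n′) + (8 * k + 3 + 4 * (2 * k + 1) * (n′ * (n′ + 2))))
  lemma = solve-∀

uColour≢wColour : ∀ {n} k → 1 ≤ n → uColour n k ≢ wColour n k
uColour≢wColour {n} k 1≤n eq = p*[1+a*p]≢2a*[2a*p+1] (m≤n+m 1 (2 * k)) (s≤s (≤-trans 1≤n (m≤m+n n _)))
  (trans (sym (double-u n k)) (trans (cong (2 *_) eq) (double-w n k)))
  where
  double-u : ∀ n k → 2 * (suc (2 * n) * (suc k + (2 * k + 1) * n)) ≡ suc (2 * n) * (1 + (2 * k + 1) * suc (2 * n))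
  double-u = solve-∀
  double-w : ∀ n k → 2 * ((2 * k + 1) * (1 + 2 * (2 * k + 1) * suc (2 * n)))
                     ≡ 2 * (2 * k + 1) * (2 * (2 * k + 1) * suc (2 * n) + 1)
  double-w = solve-∀

vColour≢wColour : ∀ {n k} → 1 ≤ n → 1 ≤ k → vColour n k ≢ wColour n k
vColour≢wColour {suc n′} {k} _ 1≤k eq = 1+a*x≢a*y (6 * n′ + 5) (4 * a) (≤-trans (*-monoʳ-≤ 2 1≤k) (m≤m+n (2 * k) 1))
  (*-cancelˡ-≡ _ _ (suc (2 * suc n′)) (+-cancelˡ-≡ (2 * a) _ _
    (trans (sym (double-v n′ k)) (trans (cong (2 *_) eq) (double-w n′ k)))))
  where
  a = 2 * k + 1
  double-v : ∀ n′ k → 2 * (suc (2 * suc n′) * suc k + (2 * k + 1) * (suc n′ * (6 * suc n′ + 1)))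
                      ≡ 2 * (2 * k + 1) + suc (2 * suc n′) * suc ((2 * k + 1) * (6 * n′ + 5))
  double-v = solve-∀
  double-w : ∀ n′ k → 2 * ((2 * k + 1) * (1 + 2 * (2 * k + 1) * suc (2 * suc n′)))
                      ≡ 2 * (2 * k + 1) + suc (2 * suc n′) * ((2 * k + 1) * (4 * (2 * k + 1)))
  double-w = solve-∀

-- Counting vertex sums

Unique-⊆⇒length≤ : ∀ {A : Set} {xs ys : List A} → Unique xs → xs ⊆ ys → length xs ≤ length ys
Unique-⊆⇒length≤ [] _ = z≤n
Unique-⊆⇒length≤ {xs = x ∷ xs} (x∉xs ∷ !xs) xs⊆ys with ∈-∃++ (xs⊆ys (here refl))
... | us , vs , refl =
  subst (suc (length xs) ≤_) (sym (length-++-sucʳ us x vs)) (s≤s (Unique-⊆⇒length≤ !xs xs⊆us++vs))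
  where
  xs⊆us++vs : xs ⊆ us ++ vs
  xs⊆us++vs {z} z∈xs with ∈-++⁻ us (xs⊆ys (there z∈xs))
  ... | inj₁ z∈us         = ∈-++⁺ˡ z∈us
  ... | inj₂ (here refl)  = contradiction refl (All.lookup x∉xs z∈xs)
  ... | inj₂ (there z∈vs) = ∈-++⁺ʳ us z∈vs

module _ (G : Graph) (σ : Labeling G) where

  private
    sums : List ℕ
    sums = map (vsum G σ) (upTo (V G))

  numColors≤ : ∀ cs → (∀ {u} → u < V G → vsum G σ u ∈ cs) → numColors G σ ≤ length cs
  numColors≤ cs covered = Unique-⊆⇒length≤ (deduplicate-! sums) λ c∈ →
    let u , u∈ , c≡ = ∈-map⁻ (vsum G σ) (∈-deduplicate⁻ _≟_ sums c∈)
    in subst (_∈ cs) (sym c≡) (covered (∈-upTo⁻ u∈))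

  ≤numColors : ∀ cs → Unique cs → (∀ {c} → c ∈ cs → ∃ λ u → u < V G × vsum G σ u ≡ c) → length cs ≤ numColors G σ
  ≤numColors cs !cs attained = Unique-⊆⇒length≤ !cs λ c∈cs →
    let u , u<V , vsum≡c = attained c∈cs
    in ∈-deduplicate⁺ _≟_ (subst (_∈ sums) vsum≡c (∈-map⁺ (vsum G σ) (∈-upTo⁺ u<V)))

  triangle⇒3≤numColors : IsLocalAntimagic G σ → ∀ {u v w} → u < V G → v < V G → w < V G →
                         Adjacent G u v → Adjacent G u w → Adjacent G v w → 3 ≤ numColors G σ
  triangle⇒3≤numColors antimagic {u} {v} {w} u<V v<V w<V uv uw vw =
    ≤numColors (f u ∷ f v ∷ f w ∷ []) ((separated uv ∷ separated uw ∷ []) ∷ (separated vw ∷ []) ∷ [] ∷ []) attained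
    where
    f = vsum G σ
    separated : ∀ {x y} → Adjacent G x y → f x ≢ f y
    separated (e , refl) = antimagic e
    attained : ∀ {c} → c ∈ (f u ∷ f v ∷ f w ∷ []) → ∃ λ x → x < V G × f x ≡ c
    attained (here refl)                 = u , u<V , refl
    attained (there (here refl))         = v , v<V , refl
    attained (there (there (here refl))) = w , w<V , refl

module Construction {n k : ℕ} (1≤n : 1 ≤ n) (1≤k : 1 ≤ k) where

  open MagicOffsets k
  m = 2 * n
  G = matchingJoinNull a m
  open LevelLabeling a m α β (λ {y} _ → α-perm y) (λ {y} _ → β-perm y)

  σ = rankLabeling

  colour-u : ∀ {i} → i < a → vsum G σ (2 * i) ≡ uColour n k
  colour-u {i} i<a = begin
    vsum G σ (2 * i)
      ≡⟨ vsum-u i<a ⟩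
    suc (m + ∑[ y < m ] suc y * a + (i + ∑[ y < m ] α y i))
      ≡⟨ cong₂ (λ T R → suc (m + T * a + R)) (gauss-even n) (α-row 1≤n i<a) ⟩
    suc (2 * n + n * suc (2 * n) * (2 * k + 1) + k * suc (2 * n))
      ≡⟨ lemma n k ⟩
    uColour n k ∎
    where
    open ≡-Reasoning
    lemma : ∀ n k → suc (2 * n + n * suc (2 * n) * (2 * k + 1) + k * suc (2 * n)) ≡ suc (2 * n) * (suc k + (2 * k + 1) * n)
    lemma = solve-∀

  colour-v : ∀ {i} → i < a → vsum G σ (suc (2 * i)) ≡ vColour n k
  colour-v {i} i<a = begin
    vsum G σ (suc (2 * i))                                             ≡⟨ vsum-v i<a ⟩
    suc (m + (m * m + ∑[ y < m ] suc y) * a + (i + ∑[ y < m ] β y i))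
      ≡⟨ cong₂ (λ T R → suc (m + (m * m + T) * a + R)) (gauss-even n) (β-row 1≤n i<a) ⟩
    suc (2 * n + (2 * n * (2 * n) + n * suc (2 * n)) * (2 * k + 1) + k * suc (2 * n)) ≡⟨ lemma n k ⟩
    vColour n k                                                        ∎
    where
    open ≡-Reasoning
    lemma : ∀ n k → suc (2 * n + (2 * n * (2 * n) + n * suc (2 * n)) * (2 * k + 1) + k * suc (2 * n))
                    ≡ suc (2 * n) * suc k + (2 * k + 1) * (n * (6 * n + 1))
    lemma = solve-∀

  colour-w : ∀ {y} → y < m → vsum G σ (2 * a + y) ≡ wColour n k
  colour-w {y} y<m = begin
    vsum G σ (2 * a + y)                                   ≡⟨ vsum-w y<m ⟩
    a * (2 + suc (m + m) * a) + ∑[ i < a ] (α y i + β y i) ≡⟨ cong (a * (2 + suc (m + m) * a) +_) (column y) ⟩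
    a * (2 + suc (m + m) * a) + a * (2 * k)                ≡⟨ lemma n k ⟩
    wColour n k                                            ∎
    where
    open ≡-Reasoning
    lemma : ∀ n k → (2 * k + 1) * (2 + suc (2 * n + 2 * n) * (2 * k + 1)) + (2 * k + 1) * (2 * k)
                    ≡ (2 * k + 1) * (1 + 2 * (2 * k + 1) * suc (2 * n))
    lemma = solve-∀

  antimagic : IsLocalAntimagic G σ
  antimagic e = separated (edgeOf {a} {m} e)
    where
    separated : ∀ {p} → EdgeOf a m p → vsum G σ (proj₁ p) ≢ vsum G σ (proj₂ p)
    separated (matchingEdge i<a) = subst₂ _≢_ (sym (colour-u i<a)) (sym (colour-v i<a)) (uColour≢vColour k 1≤n)
    separated (joinEdge x<2a y<m) with half {a} x<2a
    ... | i , i<a , inj₁ refl = subst₂ _≢_ (sym (colour-u i<a)) (sym (colour-w y<m)) (uColour≢wColour k 1≤n)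
    ... | i , i<a , inj₂ refl = subst₂ _≢_ (sym (colour-v i<a)) (sym (colour-w y<m)) (vColour≢wColour 1≤n 1≤k)

  3≤numColors : ∀ σ′ → IsLocalAntimagic G σ′ → 3 ≤ numColors G σ′
  3≤numColors σ′ antimagic′ = triangle⇒3≤numColors G σ′ antimagic′
    (≤-trans 0<2a (m≤m+n _ m)) (≤-trans 1<2a (m≤m+n _ m)) (+-monoʳ-< (2 * a) 0<m)
    (adjacent-matching {a} {m} 0<a) (adjacent-join {a} {m} 0<2a 0<m) (adjacent-join {a} {m} 1<2a 0<m)
    where
    0<a : 0 < a
    0<a = m≤n+m 1 (2 * k)
    0<m : 0 < m
    0<m = ≤-trans 1≤n (m≤m+n n _)
    1<2a : 1 < 2 * a
    1<2a = *-monoʳ-≤ 2 0<a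
    0<2a : 0 < 2 * a
    0<2a = <-trans (s≤s z≤n) 1<2a

  vsum∈colours : ∀ {u} → u < 2 * a + m → vsum G σ u ∈ (uColour n k ∷ vColour n k ∷ wColour n k ∷ [])
  vsum∈colours u< with split-<+ (2 * a) u<
  ... | inj₁ u<2a with half {a} u<2a
  ...   | i , i<a , inj₁ refl = here (colour-u i<a)
  ...   | i , i<a , inj₂ refl = there (here (colour-v i<a))
  vsum∈colours u< | inj₂ (y , y<m , refl) = there (there (here (colour-w y<m)))

  numColors≡3 : numColors G σ ≡ 3
  numColors≡3 = ≤-antisym (numColors≤ G σ _ vsum∈colours) (3≤numColors σ antimagic)

theorem2p1 : (n k : ℕ) → 1 ≤ n → 1 ≤ k →
    IsLocalAntimagicChromaticNumber (matchingJoinNull (2 * k + 1) (2 * n)) 3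
theorem2p1 n k 1≤n 1≤k = (σ , antimagic , numColors≡3) , 3≤numColors
  where open Construction 1≤n 1≤k
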